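{- The formulae and terms of stratifiable syntax, equipped with the rewrite relation $\to$ (the compatible closure of $t\in\{a\mid\phi\}\to\phi[a:=t]$), are confluent and strongly normalising.
   Context: Syntax: formulae $\phi,\psi::=\bot\mid\neg\phi\mid\phi\wedge\psi\mid\forall a.\phi\mid s\in t$ and terms $s,t::=a\mid\{a\mid\phi\}$, with $a$ ranging over variable symbols, where $\forall a$ and $\{a\mid\cdot\}$ bind $a$ and syntax is taken up to $\alpha$-equivalence; $\phi[a:=s]$ denotes capture-avoiding substitution. In stratifiable syntax (as in Quine's NF) variables carry no predetermined levels; a formula or term is stratifiable (and only then legal) if one could assign an integer level to each variable so that, extending levels to terms by $\mathrm{level}(\{a\mid\phi\})=\mathrm{level}(a)+1$, every subformula $s'\in s$ satisfies $\mathrm{level}(s)=\mathrm{level}(s')+1$. Rewriting: $\to$ is the least relation containing $t\in\{a\mid\phi\}\to\phi[a:=t]$ and closed under contexts: if $\phi\to\phi'$ then $\neg\phi\to\neg\phi'$, $\phi\wedge\psi\to\phi'\wedge\psi$, $\psi\wedge\phi\to\psi\wedge\phi'$, $\forall a.\phi\to\forall a.\phi'$, $\{a\mid\phi\}\to\{a\mid\phi'\}$; if $s\to s'$ then $t\in s\to t\in s'$ and $s\in t\to s'\in t$. -}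

module Defs where

open import Data.Nat using (ℕ; zero; suc)
open import Data.Fin using (Fin; zero; suc)
open import Data.Integer using (ℤ; _+_; 1ℤ)
open import Data.Vec.Functional using (_∷_)
open import Data.Product using (Σ; ∃; _×_)
open import Function using (flip)
open import Induction.WellFounded using (Acc)
open import Relation.Binary.Construct.Closure.ReflexiveTransitive using (Star)

-- Syntax up to α-equivalence, via (scoped) de Bruijn indices.
-- Form n / Term n : formulae / terms with at most n free variables.

data Form (n : ℕ) : Set
data Term (n : ℕ) : Set

data Form n where
  ⊥'   : Form n
  ¬'_  : Form n → Form n
  _∧'_ : Form n → Form n → Form n
  ∀'_  : Form (suc n) → Form n
  _∈'_ : Term n → Term n → Form n

data Term n where
  var  : Fin n → Term n
  ⟦_⟧  : Form (suc n) → Term n          -- { a ∣ φ }  (a = index 0)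

ext : ∀ {n m} → (Fin n → Fin m) → Fin (suc n) → Fin (suc m)
ext ρ zero    = zero
ext ρ (suc i) = suc (ρ i)

renF : ∀ {n m} → (Fin n → Fin m) → Form n → Form m
renT : ∀ {n m} → (Fin n → Fin m) → Term n → Term m
renF ρ ⊥'       = ⊥'
renF ρ (¬' φ)   = ¬' renF ρ φ
renF ρ (φ ∧' ψ) = renF ρ φ ∧' renF ρ ψ
renF ρ (∀' φ)   = ∀' renF (ext ρ) φ
renF ρ (s ∈' t) = renT ρ s ∈' renT ρ t
renT ρ (var i)  = var (ρ i)
renT ρ ⟦ φ ⟧    = ⟦ renF (ext ρ) φ ⟧

exts : ∀ {n m} → (Fin n → Term m) → Fin (suc n) → Term (suc m)
exts σ zero    = var zero
exts σ (suc i) = renT suc (σ i)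

subF : ∀ {n m} → (Fin n → Term m) → Form n → Form m
subT : ∀ {n m} → (Fin n → Term m) → Term n → Term m
subF σ ⊥'       = ⊥'
subF σ (¬' φ)   = ¬' subF σ φ
subF σ (φ ∧' ψ) = subF σ φ ∧' subF σ ψ
subF σ (∀' φ)   = ∀' subF (exts σ) φ
subF σ (s ∈' t) = subT σ s ∈' subT σ t
subT σ (var i)  = σ i
subT σ ⟦ φ ⟧    = ⟦ subF (exts σ) φ ⟧

sub₀ : ∀ {n} → Term n → Fin (suc n) → Term n
sub₀ t zero    = t
sub₀ t (suc i) = var i

_[_] : ∀ {n} → Form (suc n) → Term n → Form n
φ [ t ] = subF (sub₀ t) φ

infix 4 _⟶F_ _⟶T_

data _⟶F_ {n : ℕ} : Form n → Form n → Set
data _⟶T_ {n : ℕ} : Term n → Term n → Set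

data _⟶F_ {n} where
  β    : ∀ {t : Term n} {φ} → (t ∈' ⟦ φ ⟧) ⟶F (φ [ t ])
  ¬-c  : ∀ {φ φ'} → φ ⟶F φ' → (¬' φ) ⟶F (¬' φ')
  ∧-l  : ∀ {φ φ' ψ} → φ ⟶F φ' → (φ ∧' ψ) ⟶F (φ' ∧' ψ)
  ∧-r  : ∀ {φ φ' ψ} → φ ⟶F φ' → (ψ ∧' φ) ⟶F (ψ ∧' φ')
  ∀-c  : ∀ {φ φ' : Form (suc n)} → φ ⟶F φ' → (∀' φ) ⟶F (∀' φ')
  ∈-r  : ∀ {s s' t} → s ⟶T s' → (t ∈' s) ⟶F (t ∈' s')
  ∈-l  : ∀ {s s' t} → s ⟶T s' → (s ∈' t) ⟶F (s' ∈' t)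

data _⟶T_ {n} where
  set-c : ∀ {φ φ' : Form (suc n)} → φ ⟶F φ' → ⟦ φ ⟧ ⟶T ⟦ φ' ⟧

-- Stratification.  Γ assigns an integer level to each free variable;
-- each binder gets its own (existentially chosen) level ℓ.
-- TLev Γ t k : under Γ, the term t is well-levelled with level k.

data TLev {n : ℕ} (Γ : Fin n → ℤ) : Term n → ℤ → Set
data FStrat {n : ℕ} (Γ : Fin n → ℤ) : Form n → Set

data TLev {n} Γ where
  var : ∀ i → TLev Γ (var i) (Γ i)
  set : ∀ {φ} (ℓ : ℤ) → FStrat (ℓ ∷ Γ) φ → TLev Γ ⟦ φ ⟧ (ℓ + 1ℤ)

data FStrat {n} Γ where
  ⊥s : FStrat Γ ⊥'
  ¬s : ∀ {φ} → FStrat Γ φ → FStrat Γ (¬' φ)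
  ∧s : ∀ {φ ψ} → FStrat Γ φ → FStrat Γ ψ → FStrat Γ (φ ∧' ψ)
  ∀s : ∀ {φ} (ℓ : ℤ) → FStrat (ℓ ∷ Γ) φ → FStrat Γ (∀' φ)
  ∈s : ∀ {s t} (k : ℤ) → TLev Γ s k → TLev Γ t (k + 1ℤ) → FStrat Γ (s ∈' t)

StratifiableF : ∀ {n} → Form n → Set
StratifiableF {n} φ = Σ (Fin n → ℤ) λ Γ → FStrat Γ φ

StratifiableT : ∀ {n} → Term n → Set
StratifiableT {n} t = Σ (Fin n → ℤ) λ Γ → Σ ℤ λ k → TLev Γ t k

-- Confluence at x, and strong normalisation of x (accessibility for the
-- converse relation: no infinite reduction sequence starting at x).

ConfluentAt : ∀ {A : Set} → (A → A → Set) → A → Set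
ConfluentAt {A} R x = ∀ {y z} → Star R x y → Star R x z →
  ∃ λ w → Star R y w × Star R z w

SN : ∀ {A : Set} → (A → A → Set) → A → Set
SN R x = Acc (flip R) x

module Submission where

-- Confluence follows from SN by Newman's lemma, since reduction is locally
-- confluent: the only overlaps are a β-step against a step inside its
-- argument or inside its comprehension, which close because reduction is
-- stable under substitution.  SN is a reducibility argument in which the
-- stratification plays the role of simple types.  After choosing a floor m
-- below every level of a stratification derivation, a term of level l is
-- interpreted by the candidate R (height m l): R 0 holds of SN terms and
-- R (1+d) of SN terms t such that s ∈ t is SN for every s in R d (both
-- stable under renaming, so they can be pushed under binders).  The
-- fundamental lemma says a stratified formula under a reducible substitution
-- is SN.

open import Defs
open import Data.Nat using (ℕ; zero; suc)
import Data.Nat as ℕ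
import Data.Nat.Properties as ℕP
open import Data.Fin using (Fin; zero; suc)
open import Data.Integer using (ℤ; _+_; _-_; _≤_; _⊓_; ∣_∣; 1ℤ)
open import Data.Integer.Properties
  using (≤-refl; ≤-trans; i≤i+j; i⊓j≤i; i⊓j≤j; 0≤i⇒+∣i∣≡i; i≤j⇒0≤j-i)
open import Data.Integer.Tactic.RingSolver using (solve-∀)
open import Data.Product using (Σ; ∃; _×_; _,_; proj₁)
open import Data.Unit using (⊤; tt)
open import Data.Vec.Functional using (_∷_)
open import Function using (_∘_; id)
open import Induction.WellFounded using (acc)
open import Relation.Binary.Construct.Closure.ReflexiveTransitive
  using (Star; ε; _◅_; _◅◅_; gmap)
open import Relation.Binary.Rewriting using (WeaklyConfluent)
open import Relation.Binary.PropositionalEquality hiding ([_])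

ext-cong : ∀ {n m} {ρ ρ' : Fin n → Fin m} → (∀ i → ρ i ≡ ρ' i) → ∀ i → ext ρ i ≡ ext ρ' i
ext-cong h zero    = refl
ext-cong h (suc i) = cong suc (h i)

renF-cong : ∀ {n m} {ρ ρ' : Fin n → Fin m} → (∀ i → ρ i ≡ ρ' i) → ∀ φ → renF ρ φ ≡ renF ρ' φ
renT-cong : ∀ {n m} {ρ ρ' : Fin n → Fin m} → (∀ i → ρ i ≡ ρ' i) → ∀ t → renT ρ t ≡ renT ρ' t
renF-cong h ⊥'       = refl
renF-cong h (¬' φ)   = cong ¬'_ (renF-cong h φ)
renF-cong h (φ ∧' ψ) = cong₂ _∧'_ (renF-cong h φ) (renF-cong h ψ)
renF-cong h (∀' φ)   = cong ∀'_ (renF-cong (ext-cong h) φ)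
renF-cong h (s ∈' t) = cong₂ _∈'_ (renT-cong h s) (renT-cong h t)
renT-cong h (var i)  = cong var (h i)
renT-cong h ⟦ φ ⟧    = cong ⟦_⟧ (renF-cong (ext-cong h) φ)

exts-cong : ∀ {n m} {σ σ' : Fin n → Term m} → (∀ i → σ i ≡ σ' i) → ∀ i → exts σ i ≡ exts σ' i
exts-cong h zero    = refl
exts-cong h (suc i) = cong (renT suc) (h i)

subF-cong : ∀ {n m} {σ σ' : Fin n → Term m} → (∀ i → σ i ≡ σ' i) → ∀ φ → subF σ φ ≡ subF σ' φ
subT-cong : ∀ {n m} {σ σ' : Fin n → Term m} → (∀ i → σ i ≡ σ' i) → ∀ t → subT σ t ≡ subT σ' t
subF-cong h ⊥'       = refl
subF-cong h (¬' φ)   = cong ¬'_ (subF-cong h φ)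
subF-cong h (φ ∧' ψ) = cong₂ _∧'_ (subF-cong h φ) (subF-cong h ψ)
subF-cong h (∀' φ)   = cong ∀'_ (subF-cong (exts-cong h) φ)
subF-cong h (s ∈' t) = cong₂ _∈'_ (subT-cong h s) (subT-cong h t)
subT-cong h (var i)  = h i
subT-cong h ⟦ φ ⟧    = cong ⟦_⟧ (subF-cong (exts-cong h) φ)

ext-id : ∀ {n} (i : Fin (suc n)) → ext id i ≡ i
ext-id zero    = refl
ext-id (suc i) = refl

renF-id : ∀ {n} (φ : Form n) → renF id φ ≡ φ
renT-id : ∀ {n} (t : Term n) → renT id t ≡ t
renF-id ⊥'       = refl
renF-id (¬' φ)   = cong ¬'_ (renF-id φ)
renF-id (φ ∧' ψ) = cong₂ _∧'_ (renF-id φ) (renF-id ψ)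
renF-id (∀' φ)   = cong ∀'_ (trans (renF-cong ext-id φ) (renF-id φ))
renF-id (s ∈' t) = cong₂ _∈'_ (renT-id s) (renT-id t)
renT-id (var i)  = refl
renT-id ⟦ φ ⟧    = cong ⟦_⟧ (trans (renF-cong ext-id φ) (renF-id φ))

exts-var : ∀ {n} (i : Fin (suc n)) → exts var i ≡ var i
exts-var zero    = refl
exts-var (suc i) = refl

subF-id : ∀ {n} (φ : Form n) → subF var φ ≡ φ
subT-id : ∀ {n} (t : Term n) → subT var t ≡ t
subF-id ⊥'       = refl
subF-id (¬' φ)   = cong ¬'_ (subF-id φ)
subF-id (φ ∧' ψ) = cong₂ _∧'_ (subF-id φ) (subF-id ψ)
subF-id (∀' φ)   = cong ∀'_ (trans (subF-cong exts-var φ) (subF-id φ))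
subF-id (s ∈' t) = cong₂ _∈'_ (subT-id s) (subT-id t)
subT-id (var i)  = refl
subT-id ⟦ φ ⟧    = cong ⟦_⟧ (trans (subF-cong exts-var φ) (subF-id φ))

-- Fusion laws: a renaming or substitution followed by another is a single
-- one.  Each law relies on the previous ones to move the weakening 'suc'
-- of 'exts' past the outer map.

ext-∘ : ∀ {n m k} (ρ : Fin m → Fin k) (ρ' : Fin n → Fin m) i → ext ρ (ext ρ' i) ≡ ext (ρ ∘ ρ') i
ext-∘ ρ ρ' zero    = refl
ext-∘ ρ ρ' (suc i) = refl

renF-renF : ∀ {n m k} (ρ : Fin m → Fin k) (ρ' : Fin n → Fin m) φ → renF ρ (renF ρ' φ) ≡ renF (ρ ∘ ρ') φ
renT-renT : ∀ {n m k} (ρ : Fin m → Fin k) (ρ' : Fin n → Fin m) t → renT ρ (renT ρ' t) ≡ renT (ρ ∘ ρ') t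
renF-renF ρ ρ' ⊥'       = refl
renF-renF ρ ρ' (¬' φ)   = cong ¬'_ (renF-renF ρ ρ' φ)
renF-renF ρ ρ' (φ ∧' ψ) = cong₂ _∧'_ (renF-renF ρ ρ' φ) (renF-renF ρ ρ' ψ)
renF-renF ρ ρ' (∀' φ)   = cong ∀'_ (trans (renF-renF (ext ρ) (ext ρ') φ) (renF-cong (ext-∘ ρ ρ') φ))
renF-renF ρ ρ' (s ∈' t) = cong₂ _∈'_ (renT-renT ρ ρ' s) (renT-renT ρ ρ' t)
renT-renT ρ ρ' (var i)  = refl
renT-renT ρ ρ' ⟦ φ ⟧    = cong ⟦_⟧ (trans (renF-renF (ext ρ) (ext ρ') φ) (renF-cong (ext-∘ ρ ρ') φ))

exts-ext : ∀ {n m k} (σ : Fin m → Term k) (ρ : Fin n → Fin m) i → exts σ (ext ρ i) ≡ exts (σ ∘ ρ) i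
exts-ext σ ρ zero    = refl
exts-ext σ ρ (suc i) = refl

subF-renF : ∀ {n m k} (σ : Fin m → Term k) (ρ : Fin n → Fin m) φ → subF σ (renF ρ φ) ≡ subF (σ ∘ ρ) φ
subT-renT : ∀ {n m k} (σ : Fin m → Term k) (ρ : Fin n → Fin m) t → subT σ (renT ρ t) ≡ subT (σ ∘ ρ) t
subF-renF σ ρ ⊥'       = refl
subF-renF σ ρ (¬' φ)   = cong ¬'_ (subF-renF σ ρ φ)
subF-renF σ ρ (φ ∧' ψ) = cong₂ _∧'_ (subF-renF σ ρ φ) (subF-renF σ ρ ψ)
subF-renF σ ρ (∀' φ)   = cong ∀'_ (trans (subF-renF (exts σ) (ext ρ) φ) (subF-cong (exts-ext σ ρ) φ))
subF-renF σ ρ (s ∈' t) = cong₂ _∈'_ (subT-renT σ ρ s) (subT-renT σ ρ t)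
subT-renT σ ρ (var i)  = refl
subT-renT σ ρ ⟦ φ ⟧    = cong ⟦_⟧ (trans (subF-renF (exts σ) (ext ρ) φ) (subF-cong (exts-ext σ ρ) φ))

ext-exts : ∀ {n m k} (ρ : Fin m → Fin k) (σ : Fin n → Term m) i → renT (ext ρ) (exts σ i) ≡ exts (renT ρ ∘ σ) i
ext-exts ρ σ zero    = refl
ext-exts ρ σ (suc i) = trans (renT-renT (ext ρ) suc (σ i)) (sym (renT-renT suc ρ (σ i)))

renF-subF : ∀ {n m k} (ρ : Fin m → Fin k) (σ : Fin n → Term m) φ → renF ρ (subF σ φ) ≡ subF (renT ρ ∘ σ) φ
renT-subT : ∀ {n m k} (ρ : Fin m → Fin k) (σ : Fin n → Term m) t → renT ρ (subT σ t) ≡ subT (renT ρ ∘ σ) t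
renF-subF ρ σ ⊥'       = refl
renF-subF ρ σ (¬' φ)   = cong ¬'_ (renF-subF ρ σ φ)
renF-subF ρ σ (φ ∧' ψ) = cong₂ _∧'_ (renF-subF ρ σ φ) (renF-subF ρ σ ψ)
renF-subF ρ σ (∀' φ)   = cong ∀'_ (trans (renF-subF (ext ρ) (exts σ) φ) (subF-cong (ext-exts ρ σ) φ))
renF-subF ρ σ (s ∈' t) = cong₂ _∈'_ (renT-subT ρ σ s) (renT-subT ρ σ t)
renT-subT ρ σ (var i)  = refl
renT-subT ρ σ ⟦ φ ⟧    = cong ⟦_⟧ (trans (renF-subF (ext ρ) (exts σ) φ) (subF-cong (ext-exts ρ σ) φ))

exts-exts : ∀ {n m k} (τ : Fin m → Term k) (σ : Fin n → Term m) i → subT (exts τ) (exts σ i) ≡ exts (subT τ ∘ σ) i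
exts-exts τ σ zero    = refl
exts-exts τ σ (suc i) = trans (subT-renT (exts τ) suc (σ i)) (sym (renT-subT suc τ (σ i)))

subF-subF : ∀ {n m k} (τ : Fin m → Term k) (σ : Fin n → Term m) φ → subF τ (subF σ φ) ≡ subF (subT τ ∘ σ) φ
subT-subT : ∀ {n m k} (τ : Fin m → Term k) (σ : Fin n → Term m) t → subT τ (subT σ t) ≡ subT (subT τ ∘ σ) t
subF-subF τ σ ⊥'       = refl
subF-subF τ σ (¬' φ)   = cong ¬'_ (subF-subF τ σ φ)
subF-subF τ σ (φ ∧' ψ) = cong₂ _∧'_ (subF-subF τ σ φ) (subF-subF τ σ ψ)
subF-subF τ σ (∀' φ)   = cong ∀'_ (trans (subF-subF (exts τ) (exts σ) φ) (subF-cong (exts-exts τ σ) φ))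
subF-subF τ σ (s ∈' t) = cong₂ _∈'_ (subT-subT τ σ s) (subT-subT τ σ t)
subT-subT τ σ (var i)  = refl
subT-subT τ σ ⟦ φ ⟧    = cong ⟦_⟧ (trans (subF-subF (exts τ) (exts σ) φ) (subF-cong (exts-exts τ σ) φ))

exts-ren : ∀ {n m} (ρ : Fin n → Fin m) i → exts (var ∘ ρ) i ≡ var (ext ρ i)
exts-ren ρ zero    = refl
exts-ren ρ (suc i) = refl

renF-as-sub : ∀ {n m} (ρ : Fin n → Fin m) φ → renF ρ φ ≡ subF (var ∘ ρ) φ
renT-as-sub : ∀ {n m} (ρ : Fin n → Fin m) t → renT ρ t ≡ subT (var ∘ ρ) t
renF-as-sub ρ ⊥'       = refl
renF-as-sub ρ (¬' φ)   = cong ¬'_ (renF-as-sub ρ φ)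
renF-as-sub ρ (φ ∧' ψ) = cong₂ _∧'_ (renF-as-sub ρ φ) (renF-as-sub ρ ψ)
renF-as-sub ρ (∀' φ)   = cong ∀'_ (trans (renF-as-sub (ext ρ) φ) (sym (subF-cong (exts-ren ρ) φ)))
renF-as-sub ρ (s ∈' t) = cong₂ _∈'_ (renT-as-sub ρ s) (renT-as-sub ρ t)
renT-as-sub ρ (var i)  = refl
renT-as-sub ρ ⟦ φ ⟧    = cong ⟦_⟧ (trans (renF-as-sub (ext ρ) φ) (sym (subF-cong (exts-ren ρ) φ)))

-- Instantiating the bound variable of a body lifted past σ by s amounts to
-- substituting s ∷ σ; this is the shape of a β-redex under a substitution.

lifted-instance : ∀ {n m} (σ : Fin n → Term m) (φ : Form (suc n)) (s : Term m) →
  (subF (exts σ) φ) [ s ] ≡ subF (s ∷ σ) φ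
lifted-instance σ φ s = trans (subF-subF (sub₀ s) (exts σ) φ) (subF-cong instance-pointwise φ)
  where
  instance-pointwise : ∀ i → subT (sub₀ s) (exts σ i) ≡ (s ∷ σ) i
  instance-pointwise zero    = refl
  instance-pointwise (suc i) = trans (subT-renT (sub₀ s) suc (σ i)) (subT-id (σ i))

subF-[] : ∀ {n m} (σ : Fin n → Term m) (φ : Form (suc n)) t →
  subF σ (φ [ t ]) ≡ (subF (exts σ) φ) [ subT σ t ]
subF-[] σ φ t = trans (subF-subF σ (sub₀ t) φ)
  (trans (subF-cong pointwise φ) (sym (lifted-instance σ φ (subT σ t))))
  where
  pointwise : ∀ i → subT σ (sub₀ t i) ≡ (subT σ t ∷ σ) i
  pointwise zero    = refl
  pointwise (suc i) = refl

infix 4 _⟶F*_ _⟶T*_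

_⟶F*_ : ∀ {n} → Form n → Form n → Set
_⟶F*_ = Star _⟶F_

_⟶T*_ : ∀ {n} → Term n → Term n → Set
_⟶T*_ = Star _⟶T_

subF-step : ∀ {n m} (σ : Fin n → Term m) {φ φ'} → φ ⟶F φ' → subF σ φ ⟶F subF σ φ'
subT-step : ∀ {n m} (σ : Fin n → Term m) {t t'} → t ⟶T t' → subT σ t ⟶T subT σ t'
subF-step σ (β {t} {φ}) = subst (subF σ (t ∈' ⟦ φ ⟧) ⟶F_) (sym (subF-[] σ φ t)) β
subF-step σ (¬-c r)     = ¬-c (subF-step σ r)
subF-step σ (∧-l r)     = ∧-l (subF-step σ r)
subF-step σ (∧-r r)     = ∧-r (subF-step σ r)
subF-step σ (∀-c r)     = ∀-c (subF-step (exts σ) r)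
subF-step σ (∈-r r)     = ∈-r (subT-step σ r)
subF-step σ (∈-l r)     = ∈-l (subT-step σ r)
subT-step σ (set-c r)   = set-c (subF-step (exts σ) r)

-- A renaming is a substitution, so renamings preserve reduction too.
renT-steps : ∀ {n m} (ρ : Fin n → Fin m) {t t'} → t ⟶T* t' → renT ρ t ⟶T* renT ρ t'
renT-steps ρ = gmap (renT ρ) renT-step
  where
  renT-step : ∀ {t t'} → t ⟶T t' → renT ρ t ⟶T renT ρ t'
  renT-step {t} {t'} r =
    subst₂ _⟶T_ (sym (renT-as-sub ρ t)) (sym (renT-as-sub ρ t')) (subT-step (var ∘ ρ) r)

subF-args : ∀ {n m} {σ τ : Fin n → Term m} → (∀ i → σ i ⟶T* τ i) → ∀ φ → subF σ φ ⟶F* subF τ φ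
subT-args : ∀ {n m} {σ τ : Fin n → Term m} → (∀ i → σ i ⟶T* τ i) → ∀ t → subT σ t ⟶T* subT τ t
exts-args : ∀ {n m} {σ τ : Fin n → Term m} → (∀ i → σ i ⟶T* τ i) → ∀ i → exts σ i ⟶T* exts τ i
exts-args h zero    = ε
exts-args h (suc i) = renT-steps suc (h i)
subF-args h ⊥'       = ε
subF-args h (¬' φ)   = gmap ¬'_ ¬-c (subF-args h φ)
subF-args {σ = σ} {τ} h (φ ∧' ψ) =
  gmap (_∧' subF σ ψ) ∧-l (subF-args h φ) ◅◅ gmap (subF τ φ ∧'_) ∧-r (subF-args h ψ)
subF-args h (∀' φ)   = gmap ∀'_ ∀-c (subF-args (exts-args h) φ)
subF-args {σ = σ} {τ} h (s ∈' t) =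
  gmap (_∈' subT σ t) ∈-l (subT-args h s) ◅◅ gmap (subT τ s ∈'_) ∈-r (subT-args h t)
subT-args h (var i)  = h i
subT-args h ⟦ φ ⟧    = gmap ⟦_⟧ set-c (subF-args (exts-args h) φ)

instance-arg : ∀ {n} (φ : Form (suc n)) {t t' : Term n} → t ⟶T t' → φ [ t ] ⟶F* φ [ t' ]
instance-arg φ r = subF-args sub₀-steps φ
  where
  sub₀-steps : ∀ i → sub₀ _ i ⟶T* sub₀ _ i
  sub₀-steps zero    = r ◅ ε
  sub₀-steps (suc i) = ε

-- Newman's lemma at a point: a locally confluent relation is confluent at
-- every strongly normalising element (by well-founded induction: close the
-- first two steps locally, then join the three resulting peaks below).

newman : ∀ {A : Set} {R : A → A → Set} → WeaklyConfluent R → ∀ {x} → SN R x → ConfluentAt R x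
newman lc _ ε q = _ , q , ε
newman lc _ (p ◅ ps) ε = _ , ε , p ◅ ps
newman lc (acc rs) (p ◅ ps) (q ◅ qs) with lc p q
... | w₀ , yw₀ , zw₀ with newman lc (rs p) ps yw₀
... | w₁ , yw₁ , w₀w₁ with newman lc (rs q) qs (zw₀ ◅◅ w₀w₁)
... | w₂ , zw₂ , w₁w₂ = w₂ , yw₁ ◅◅ w₁w₂ , zw₂

Joinable : ∀ {A : Set} → (A → A → Set) → A → A → Set
Joinable R y z = ∃ λ w → Star R y w × Star R z w

join-map : ∀ {A B : Set} {R : A → A → Set} {S : B → B → Set} (f : A → B) →
  (∀ {a a'} → R a a' → S (f a) (f a')) → ∀ {y z} → Joinable R y z → Joinable S (f y) (f z)
join-map f step (w , yw , zw) = f w , gmap f step yw , gmap f step zw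

-- Local confluence.  Steps in disjoint positions commute; a β-step against a
-- step in the comprehension or in the argument closes by stability of
-- reduction under substitution.

lcF : ∀ {n} → WeaklyConfluent (_⟶F_ {n})
lcT : ∀ {n} → WeaklyConfluent (_⟶T_ {n})
lcF β β = _ , ε , ε
lcF (β {t}) (∈-r (set-c r)) = _ , subF-step (sub₀ t) r ◅ ε , β ◅ ε
lcF (β {φ = φ}) (∈-l r)     = _ , instance-arg φ r , β ◅ ε
lcF (∈-r (set-c r)) (β {t}) = _ , β ◅ ε , subF-step (sub₀ t) r ◅ ε
lcF (∈-l r) (β {φ = φ})     = _ , β ◅ ε , instance-arg φ r
lcF (¬-c r) (¬-c q)         = join-map ¬'_ ¬-c (lcF r q)
lcF (∧-l {ψ = ψ} r) (∧-l q) = join-map (_∧' ψ) ∧-l (lcF r q)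
lcF (∧-l r) (∧-r q)         = _ , ∧-r q ◅ ε , ∧-l r ◅ ε
lcF (∧-r q) (∧-l r)         = _ , ∧-l r ◅ ε , ∧-r q ◅ ε
lcF (∧-r {ψ = ψ} r) (∧-r q) = join-map (ψ ∧'_) ∧-r (lcF r q)
lcF (∀-c r) (∀-c q)         = join-map ∀'_ ∀-c (lcF r q)
lcF (∈-r {t = t} r) (∈-r q) = join-map (t ∈'_) ∈-r (lcT r q)
lcF (∈-r r) (∈-l q)         = _ , ∈-l q ◅ ε , ∈-r r ◅ ε
lcF (∈-l q) (∈-r r)         = _ , ∈-r r ◅ ε , ∈-l q ◅ ε
lcF (∈-l {t = t} r) (∈-l q) = join-map (_∈' t) ∈-l (lcT r q)
lcT (set-c r) (set-c q)     = join-map ⟦_⟧ set-c (lcF r q)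

-- Apart from a β-redex
-- at the root, every step of a compound expression is a step of one of its
-- immediate parts, so SN is inherited from the parts.

SNF : ∀ {n} → Form n → Set
SNF = SN _⟶F_

SNT : ∀ {n} → Term n → Set
SNT = SN _⟶T_

SN-reduct : ∀ {A : Set} {R : A → A → Set} {x y} → SN R x → Star R x y → SN R y
SN-reduct sn ε              = sn
SN-reduct (acc rs) (r ◅ rs') = SN-reduct (rs r) rs'

SN-⊥ : ∀ {n} → SNF (⊥' {n})
SN-⊥ = acc λ ()

SN-¬ : ∀ {n} {φ : Form n} → SNF φ → SNF (¬' φ)
SN-¬ (acc rs) = acc λ { (¬-c r) → SN-¬ (rs r) }

SN-∧ : ∀ {n} {φ ψ : Form n} → SNF φ → SNF ψ → SNF (φ ∧' ψ)
SN-∧ (acc rφ) (acc rψ) = acc λ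
  { (∧-l r) → SN-∧ (rφ r) (acc rψ)
  ; (∧-r r) → SN-∧ (acc rφ) (rψ r) }

SN-∀ : ∀ {n} {φ : Form (suc n)} → SNF φ → SNF (∀' φ)
SN-∀ (acc rs) = acc λ { (∀-c r) → SN-∀ (rs r) }

SN-var : ∀ {n} {i : Fin n} → SNT (var i)
SN-var = acc λ ()

SN-set : ∀ {n} {φ : Form (suc n)} → SNF φ → SNT ⟦ φ ⟧
SN-set (acc rs) = acc λ { (set-c r) → SN-set (rs r) }

SN-∈var : ∀ {n} {s : Term n} {i} → SNT s → SNF (s ∈' var i)
SN-∈var (acc rs) = acc λ { (∈-l r) → SN-∈var (rs r) ; (∈-r ()) }

-- The β-redex s ∈ {a ∣ ψ} is SN as soon as s, ψ and its contractum ψ[s] are: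
-- reducing s or ψ first leads to a reduct of ψ[s], which stays SN.

SN-β : ∀ {n} {s : Term n} {ψ} → SNT s → SNF ψ → SNF (ψ [ s ]) → SNF (s ∈' ⟦ ψ ⟧)
SN-β {ψ = ψ} (acc rs) (acc rψ) snψ[s] = acc λ
  { β               → snψ[s]
  ; (∈-l r)         → SN-β (rs r) (acc rψ) (SN-reduct snψ[s] (instance-arg ψ r))
  ; (∈-r (set-c r)) → SN-β (acc rs) (rψ r) (SN-reduct snψ[s] (subF-step _ r ◅ ε)) }

-- Reducibility candidates, indexed by a height d ∈ ℕ.  'Stable P t' says
-- that P holds of every renaming of t; it makes candidates closed under the
-- weakenings needed to go under binders.

Stable : (∀ {k} → Term k → Set) → ∀ {n} → Term n → Set
Stable P {n} t = ∀ {k} (ρ : Fin n → Fin k) → P (renT ρ t)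

stable-ren : ∀ {P : ∀ {k} → Term k → Set} {n m} (ρ : Fin n → Fin m) {t} →
  Stable P t → Stable P (renT ρ t)
stable-ren {P} ρ {t} h ρ' = subst P (sym (renT-renT ρ' ρ t)) (h (ρ' ∘ ρ))

stable-sub : ∀ {P : ∀ {k} → Term k → Set} {n m} (σ : Fin n → Term m) t →
  (∀ {k} (ρ : Fin m → Fin k) → P (subT (renT ρ ∘ σ) t)) → Stable P (subT σ t)
stable-sub {P} σ t h ρ = subst P (sym (renT-subT ρ σ t)) (h ρ)

R : ℕ → ∀ {n} → Term n → Set
SNMembers : ℕ → ∀ {n} → Term n → Set
R zero    t = Stable SNT t
R (suc d) t = Stable SNT t × Stable (SNMembers d) t
SNMembers d {n} u = ∀ (s : Term n) → R d s → SNF (s ∈' u)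

R-stable-SN : ∀ d {n} {t : Term n} → R d t → Stable SNT t
R-stable-SN zero    h = h
R-stable-SN (suc d) h = proj₁ h

R-SN : ∀ d {n} {t : Term n} → R d t → SNT t
R-SN d {t = t} h = subst SNT (renT-id t) (R-stable-SN d h id)

R-ren : ∀ d {n m} (ρ : Fin n → Fin m) {t} → R d t → R d (renT ρ t)
R-ren zero    ρ h          = stable-ren {SNT} ρ h
R-ren (suc d) ρ (sn , mem) = stable-ren {SNT} ρ sn , stable-ren {SNMembers d} ρ mem

R-var : ∀ d {n} (i : Fin n) → R d (var i)
R-var zero    i = λ ρ → SN-var
R-var (suc d) i = (λ ρ → SN-var) , (λ ρ s r → SN-∈var (R-SN d r))

R-member : ∀ d {n} {s t : Term n} → R (suc d) t → R d s → SNF (s ∈' t)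
R-member d {s = s} {t} (_ , mem) r = subst (λ u → SNF (s ∈' u)) (renT-id t) (mem id s r)

AboveF : ℤ → ∀ {n} {Γ : Fin n → ℤ} {φ} → FStrat Γ φ → Set
AboveT : ℤ → ∀ {n} {Γ : Fin n → ℤ} {t k} → TLev Γ t k → Set
AboveF m ⊥s         = ⊤
AboveF m (¬s d)     = AboveF m d
AboveF m (∧s d e)   = AboveF m d × AboveF m e
AboveF m (∀s ℓ d)   = AboveF m d
AboveF m (∈s k d e) = AboveT m d × AboveT m e
AboveT m {Γ = Γ} (var i) = m ≤ Γ i
AboveT m (set ℓ d)       = m ≤ ℓ × AboveF m d

lowerF : ∀ {m' m} → m' ≤ m → ∀ {n} {Γ : Fin n → ℤ} {φ} (d : FStrat Γ φ) → AboveF m d → AboveF m' d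
lowerT : ∀ {m' m} → m' ≤ m → ∀ {n} {Γ : Fin n → ℤ} {t k} (d : TLev Γ t k) → AboveT m d → AboveT m' d
lowerF le ⊥s         tt      = tt
lowerF le (¬s d)     a       = lowerF le d a
lowerF le (∧s d e)   (a , b) = lowerF le d a , lowerF le e b
lowerF le (∀s ℓ d)   a       = lowerF le d a
lowerF le (∈s k d e) (a , b) = lowerT le d a , lowerT le e b
lowerT le (var i)    a       = ≤-trans le a
lowerT le (set ℓ d)  (a , b) = ≤-trans le a , lowerF le d b

common-floor : ∀ {A B : ℤ → Set} → (∀ {m' m} → m' ≤ m → A m → A m') → (∀ {m' m} → m' ≤ m → B m → B m') →
  Σ ℤ A → Σ ℤ B → Σ ℤ λ m → A m × B m
common-floor lowerA lowerB (m₁ , a) (m₂ , b) = m₁ ⊓ m₂ , lowerA (i⊓j≤i m₁ m₂) a , lowerB (i⊓j≤j m₁ m₂) b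

floorF : ∀ {n} {Γ : Fin n → ℤ} {φ} (d : FStrat Γ φ) → Σ ℤ λ m → AboveF m d
floorT : ∀ {n} {Γ : Fin n → ℤ} {t k} (d : TLev Γ t k) → Σ ℤ λ m → AboveT m d
floorF ⊥s         = 1ℤ , tt
floorF (¬s d)     = floorF d
floorF (∧s d e)   = common-floor (λ le → lowerF le d) (λ le → lowerF le e) (floorF d) (floorF e)
floorF (∀s ℓ d)   = floorF d
floorF (∈s k d e) = common-floor (λ le → lowerT le d) (λ le → lowerT le e) (floorT d) (floorT e)
floorT {Γ = Γ} (var i) = Γ i , ≤-refl
floorT (set ℓ d)       = common-floor (λ le a → ≤-trans le a) (λ le → lowerF le d) (ℓ , ≤-refl) (floorF d)

level-above : ∀ {m n} {Γ : Fin n → ℤ} {t k} (d : TLev Γ t k) → AboveT m d → m ≤ k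
level-above (var i)   m≤Γi       = m≤Γi
level-above (set ℓ d) (m≤ℓ , _) = ≤-trans m≤ℓ (i≤i+j ℓ 1ℤ)

height : ℤ → ℤ → ℕ
height m k = ∣ k - m ∣

height-suc : ∀ {m k} → m ≤ k → height m (k + 1ℤ) ≡ suc (height m k)
height-suc {m} {k} m≤k = begin
  height m (k + 1ℤ)      ≡⟨ cong ∣_∣ (reorder k m) ⟩
  ∣ (k - m) + 1ℤ ∣       ≡⟨ cong (λ x → ∣ x + 1ℤ ∣) (sym (0≤i⇒+∣i∣≡i (i≤j⇒0≤j-i m≤k))) ⟩
  height m k ℕ.+ 1       ≡⟨ ℕP.+-comm (height m k) 1 ⟩
  suc (height m k)       ∎
  where
  open ≡-Reasoning
  reorder : ∀ k m → k + 1ℤ - m ≡ (k - m) + 1ℤ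
  reorder = solve-∀

module Fundamental (m : ℤ) where

  Reducible : ∀ {n k} → (Fin n → ℤ) → (Fin n → Term k) → Set
  Reducible Γ σ = ∀ i → R (height m (Γ i)) (σ i)

  reducible-ren : ∀ {n k k'} {Γ : Fin n → ℤ} {σ : Fin n → Term k} (ρ : Fin k → Fin k') →
    Reducible Γ σ → Reducible Γ (renT ρ ∘ σ)
  reducible-ren ρ red i = R-ren _ ρ (red i)

  reducible-exts : ∀ {n k} {Γ : Fin n → ℤ} {σ : Fin n → Term k} (ℓ : ℤ) →
    Reducible Γ σ → Reducible (ℓ ∷ Γ) (exts σ)
  reducible-exts ℓ red zero    = R-var _ zero
  reducible-exts ℓ red (suc i) = R-ren _ suc (red i)

  reducible-cons : ∀ {n k} {Γ : Fin n → ℤ} {σ : Fin n → Term k} {ℓ s} →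
    R (height m ℓ) s → Reducible Γ σ → Reducible (ℓ ∷ Γ) (s ∷ σ)
  reducible-cons r red zero    = r
  reducible-cons r red (suc i) = red i

  fundF : ∀ {n k} {Γ : Fin n → ℤ} {φ} (d : FStrat Γ φ) → AboveF m d →
    (σ : Fin n → Term k) → Reducible Γ σ → SNF (subF σ φ)
  fundT : ∀ {n k} {Γ : Fin n → ℤ} {t l} (d : TLev Γ t l) → AboveT m d →
    (σ : Fin n → Term k) → Reducible Γ σ → R (height m l) (subT σ t)
  fundF ⊥s         _       σ red = SN-⊥
  fundF (¬s d)     a       σ red = SN-¬ (fundF d a σ red)
  fundF (∧s d e)   (a , b) σ red = SN-∧ (fundF d a σ red) (fundF e b σ red)
  fundF (∀s ℓ d)   a       σ red = SN-∀ (fundF d a (exts σ) (reducible-exts ℓ red))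
  fundF (∈s {t = t} k d e) (a , b) σ red = R-member _ t-reducible (fundT d a σ red)
    where
    t-reducible : R (suc (height m k)) (subT σ t)
    t-reducible = subst (λ h → R h (subT σ t)) (height-suc (level-above d a)) (fundT e b σ red)
  fundT (var i)    _       σ red = red i
  fundT {Γ = Γ} (set {φ} ℓ d) (m≤ℓ , a) σ red =
    subst (λ h → R h (subT σ ⟦ φ ⟧)) (sym (height-suc m≤ℓ)) (set-SN , set-members)
    where
    body : ∀ {k'} (ρ : _ → Fin k') (s : Term k') → R (height m ℓ) s →
      SNF (subF (s ∷ (renT ρ ∘ σ)) φ)
    body ρ s r = fundF d a _ (reducible-cons r (reducible-ren {Γ = Γ} ρ red))
    lifted-body : ∀ {k'} (ρ : _ → Fin k') → SNF (subF (exts (renT ρ ∘ σ)) φ)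
    lifted-body ρ = fundF d a _ (reducible-exts ℓ (reducible-ren {Γ = Γ} ρ red))
    set-SN : Stable SNT (subT σ ⟦ φ ⟧)
    set-SN = stable-sub {SNT} σ ⟦ φ ⟧ λ ρ → SN-set (lifted-body ρ)
    set-members : Stable (SNMembers (height m ℓ)) (subT σ ⟦ φ ⟧)
    set-members = stable-sub {SNMembers (height m ℓ)} σ ⟦ φ ⟧ λ ρ s r →
      SN-β (R-SN _ r) (lifted-body ρ) (subst SNF (sym (lifted-instance _ φ s)) (body ρ s r))

SN-stratified-form : ∀ {n} {Γ : Fin n → ℤ} {φ} → FStrat Γ φ → SNF φ
SN-stratified-form {φ = φ} d with floorF d
... | m , a = subst SNF (subF-id φ) (Fundamental.fundF m d a var (λ i → R-var _ i))

SN-stratified-term : ∀ {n} {Γ : Fin n → ℤ} {t k} → TLev Γ t k → SNT t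
SN-stratified-term (var i)   = SN-var
SN-stratified-term (set ℓ d) = SN-set (SN-stratified-form d)

theorem5p32 : ((∀ {n} (φ : Form n) → StratifiableF φ → ConfluentAt _⟶F_ φ × SN _⟶F_ φ)
              × (∀ {n} (t : Term n) → StratifiableT t → ConfluentAt _⟶T_ t × SN _⟶T_ t))
theorem5p32 = forms , terms
  where
  forms : ∀ {n} (φ : Form n) → StratifiableF φ → ConfluentAt _⟶F_ φ × SN _⟶F_ φ
  forms φ (_ , d) = newman lcF sn , sn
    where sn = SN-stratified-form d
  terms : ∀ {n} (t : Term n) → StratifiableT t → ConfluentAt _⟶T_ t × SN _⟶T_ t
  terms t (_ , _ , d) = newman lcT sn , sn
    where sn = SN-stratified-term d
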